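{- Let $s\geq 2$ and let $n\in\{2s+1,2s+2\}$ with $\gcd(n,s)=1$. The circulant graph $\mathrm{circ}(n;\pm1,\pm s)$ is not $3$-spanning cyclable.
   Context: $\mathrm{circ}(n;\pm1,\pm s)$ is the Cayley graph on $\mathbb{Z}/n\mathbb{Z}$ with connection set $\{\pm1,\pm s\}$: vertices $u_0,\dots,u_{n-1}$ (indices mod $n$), with $u_i$ adjacent to $u_{i\pm1}$ and $u_{i\pm s}$. A 2-factor of a graph is a spanning subgraph in which every vertex has valency 2; it separates a set $A$ of $k$ vertices if it consists of exactly $k$ cycles and $A$ meets the vertex set of each cycle in exactly one vertex. A graph $X$ is $k$-spanning cyclable if for every $A\subseteq V(X)$ with $|A|=k$ there is a 2-factor of $X$ separating $A$. -}

module Defs where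

open import Data.Nat using (ℕ; zero; suc; _+_; _*_)
open import Data.Fin using (Fin; toℕ)
open import Data.Bool using (Bool; true; false; if_then_else_)
open import Data.List using (List; map; allFin)
open import Data.Nat.ListAction using (sum)
open import Data.Product using (Σ; ∃; _×_; _,_)
open import Data.Sum using (_⊎_)
open import Relation.Binary.PropositionalEquality using (_≡_; _≢_)
open import Relation.Binary.Construct.Closure.ReflexiveTransitive using (Star)

ShiftEq : (n : ℕ) → Fin n → ℕ → Fin n → Set
ShiftEq n x d y = ∃ λ k → toℕ x + d ≡ toℕ y + k * n

CircAdj : (n s : ℕ) → Fin n → Fin n → Set
CircAdj n s i j =
  ShiftEq n i 1 j ⊎ ShiftEq n j 1 i ⊎ ShiftEq n i s j ⊎ ShiftEq n j s i

Subgraph : ℕ → Set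
Subgraph n = Fin n → Fin n → Bool

degree : ∀ {n} → Subgraph n → Fin n → ℕ
degree {n} F i = sum (map (λ j → if F i j then 1 else 0) (allFin n))

record IsTwoFactor (n s : ℕ) (F : Subgraph n) : Set where
  field
    symmetric : ∀ i j → F i j ≡ F j i
    loopless  : ∀ i → F i i ≡ false
    edges     : ∀ i j → F i j ≡ true → CircAdj n s i j
    valency2  : ∀ i → degree F i ≡ 2

SameCycle : ∀ {n} → Subgraph n → Fin n → Fin n → Set
SameCycle F = Star (λ i j → F i j ≡ true)

-- the 2-factor F separates the 3-set {a, b, c}: the cycles of F are in
-- bijection with {a,b,c}, i.e. every cycle contains one of a, b, c and
-- no cycle contains two of them (so F has exactly 3 cycles)
Separates3 : ∀ {n} → Subgraph n → Fin n → Fin n → Fin n → Set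
Separates3 F a b c =
  (∀ v → SameCycle F v a ⊎ SameCycle F v b ⊎ SameCycle F v c) ×
  ((SameCycle F a b → Data.Empty.⊥) × (SameCycle F a c → Data.Empty.⊥) ×
   (SameCycle F b c → Data.Empty.⊥))
  where import Data.Empty

ThreeSpanningCyclable : ℕ → ℕ → Set
ThreeSpanningCyclable n s =
  ∀ (a b c : Fin n) → a ≢ b → a ≢ c → b ≢ c →
  Σ (Subgraph n) λ F → IsTwoFactor n s F × Separates3 F a b c

{-# OPTIONS --safe #-}
-- In a 2-factor separating a 3-set A, no vertex of A has an edge into A. For
-- n = 2s+1 take A = {u₀, uₛ, u₂ₛ}: the remaining neighbours of u₀ and of uₛ lie in
-- {u₁, uₛ₋₁, uₛ₊₁}. For n = 2s+2 take A = {u₀, u₁, uₛ₊₁}: the remaining neighbours of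
-- u₀ and of uₛ₊₁ lie in {uₛ, uₛ₊₂, u₂ₛ₊₁}. Two vertices of valency 2 whose neighbours
-- lie in a common 3-set share a neighbour, so they lie on one cycle: a contradiction.
module Submission where

open import Defs
open import Data.Nat using (ℕ; _+_; _*_; _≤_)
open import Data.Nat.GCD using (gcd)
open import Data.Sum using (_⊎_)
open import Relation.Binary.PropositionalEquality using (_≡_)
open import Relation.Nullary using (¬_)

open import Data.Bool using (Bool; true; false; if_then_else_)
open import Data.Empty using (⊥-elim)
open import Data.Fin using (Fin; toℕ; fromℕ<; zero; suc)
open import Data.Fin.Properties
  using (toℕ-injective; toℕ<n; toℕ-fromℕ<; fromℕ<-injective; suc-injective; 0≢1+n)
open import Data.List using (tabulate)
open import Data.List.Properties using (map-tabulate)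
open import Data.Nat using (zero; suc; _<_; z≤n; s≤s)
open import Data.Nat.DivMod using (_%_; m<n⇒m%n≡m; [m+kn]%n≡m%n)
open import Data.Nat.ListAction using (sum)
open import Data.Nat.Properties
  using (+-comm; +-identityʳ; +-cancelʳ-≡; m≤m+n; m≤n+m; m≤n⇒m≤1+n; n<1+n; m≢1+n+m; 1+n≰n;
         +-commutativeSemigroup)
open import Algebra.Properties.CommutativeSemigroup +-commutativeSemigroup using (xy∙z≈xz∙y)
open import Data.Nat.Tactic.RingSolver using (solve-∀)
open import Data.Product using (∃; _×_; _,_; proj₂)
open import Data.Sum using (inj₁; inj₂)
import Data.Sum as Sum
open import Function using (_∘_)
open import Relation.Binary.Construct.Closure.ReflexiveTransitive using (ε; _◅_)
open import Relation.Binary.PropositionalEquality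
  using (refl; sym; trans; cong; subst; subst₂; module ≡-Reasoning)

count : ∀ {n} → (Fin n → Bool) → ℕ
count f = sum (tabulate (λ j → if f j then 1 else 0))

degree≡count : ∀ {n} (F : Subgraph n) i → degree F i ≡ count (F i)
degree≡count F i = cong sum (map-tabulate (λ j → j) (λ j → if F i j then 1 else 0))

count≡0 : ∀ {n} (f : Fin n → Bool) → (∀ j → ¬ f j ≡ true) → count f ≡ 0
count≡0 {zero}  f none = refl
count≡0 {suc n} f none with f zero in f₀
... | true  = ⊥-elim (none zero f₀)
... | false = count≡0 (f ∘ suc) (none ∘ suc)

count≤1 : ∀ {n} (f : Fin n → Bool) u → (∀ j → f j ≡ true → j ≡ u) → count f ≤ 1
count≤1 {suc n} f zero only-u
  rewrite count≡0 (f ∘ suc) (λ j → 0≢1+n ∘ sym ∘ only-u (suc j)) with f zero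
... | true  = s≤s z≤n
... | false = z≤n
count≤1 {suc n} f (suc u) only-u with f zero in f₀
... | true  with () ← only-u zero f₀
... | false = count≤1 (f ∘ suc) u (λ j → suc-injective ∘ only-u (suc j))

exclude : ∀ {n} {f : Fin n → Bool} {u j} {A : Set} → f u ≡ false → f j ≡ true → j ≡ u ⊎ A → A
exclude fu fj (inj₁ refl) with () ← trans (sym fj) fu
exclude fu fj (inj₂ a)    = a

SupportedIn : ∀ {n} → (Fin n → Bool) → Fin n → Fin n → Fin n → Set
SupportedIn f t₁ t₂ t₃ = ∀ j → f j ≡ true → j ≡ t₁ ⊎ j ≡ t₂ ⊎ j ≡ t₃

module CountTwo {n} {f : Fin n → Bool} (count≡2 : count f ≡ 2) where

  not-single : ∀ u → ¬ (∀ j → f j ≡ true → j ≡ u)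
  not-single u = 1+n≰n ∘ subst (_≤ 1) count≡2 ∘ count≤1 f u

  hits-both : ∀ {u v} → (∀ j → f j ≡ true → j ≡ u ⊎ j ≡ v) → f u ≡ true × f v ≡ true
  hits-both {u} {v} supp with f u in fu | f v in fv
  ... | true  | true  = refl , refl
  ... | false | _     = ⊥-elim (not-single v λ j fj → exclude fu fj (supp j fj))
  ... | true  | false = ⊥-elim (not-single u λ j fj → exclude fv fj (Sum.swap (supp j fj)))

  module _ {t₁ t₂ t₃} (supp : SupportedIn f t₁ t₂ t₃) where

    misses-first⇒hits-others : f t₁ ≡ false → f t₂ ≡ true × f t₃ ≡ true
    misses-first⇒hits-others f₁ = hits-both λ j fj → exclude f₁ fj (supp j fj)

    hits-second-or-third : f t₂ ≡ true ⊎ f t₃ ≡ true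
    hits-second-or-third with f t₂ in f₂
    ... | true  = inj₁ refl
    ... | false = inj₂ (proj₂ (hits-both λ j fj → Sum.map₂ (exclude f₂ fj) (supp j fj)))

common-element : ∀ {n} {f g : Fin n → Bool} {t₁ t₂ t₃} → count f ≡ 2 → count g ≡ 2 →
  SupportedIn f t₁ t₂ t₃ → SupportedIn g t₁ t₂ t₃ → ∃ λ t → f t ≡ true × g t ≡ true
common-element {f = f} {g} {t₁} {t₂} {t₃} cf cg sf sg with f t₁ in f₁ | g t₁ in g₁
... | true  | true  = t₁ , f₁ , g₁
... | false | _     = let f₂ , f₃ = CountTwo.misses-first⇒hits-others cf sf f₁ in
  Sum.[ (λ g₂ → t₂ , f₂ , g₂) , (λ g₃ → t₃ , f₃ , g₃) ] (CountTwo.hits-second-or-third cg sg)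
... | true  | false = let g₂ , g₃ = CountTwo.misses-first⇒hits-others cg sg g₁ in
  Sum.[ (λ f₂ → t₂ , f₂ , g₂) , (λ f₃ → t₃ , f₃ , g₃) ] (CountTwo.hits-second-or-third cf sf)

module _ {n s} {F : Subgraph n} (two-factor : IsTwoFactor n s F) where
  open IsTwoFactor two-factor

  count-neighbours≡2 : ∀ v → count (F v) ≡ 2
  count-neighbours≡2 v = trans (sym (degree≡count F v)) (valency2 v)

  sameCycle-of-neighbours-in : ∀ {x y t₁ t₂ t₃} →
    SupportedIn (F x) t₁ t₂ t₃ → SupportedIn (F y) t₁ t₂ t₃ → SameCycle F x y
  sameCycle-of-neighbours-in {x} {y} sx sy
    with common-element (count-neighbours≡2 x) (count-neighbours≡2 y) sx sy
  ... | t , Fxt , Fyt = Fxt ◅ trans (symmetric t y) Fyt ◅ ε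

m+kn≡o+ln⇒m≡o : ∀ {m o n} k l → m < n → o < n → m + k * n ≡ o + l * n → m ≡ o
m+kn≡o+ln⇒m≡o {m} {o} {n@(suc _)} k l m<n o<n eq = begin
  m               ≡⟨ m<n⇒m%n≡m m<n ⟨
  m % n           ≡⟨ [m+kn]%n≡m%n m k n ⟨
  (m + k * n) % n ≡⟨ cong (_% n) eq ⟩
  (o + l * n) % n ≡⟨ [m+kn]%n≡m%n o l n ⟩
  o % n           ≡⟨ m<n⇒m%n≡m o<n ⟩
  o               ∎
  where open ≡-Reasoning

shiftEq-functional : ∀ {n x d y y′} → ShiftEq n x d y → ShiftEq n x d y′ → y ≡ y′
shiftEq-functional {y = y} {y′} (k , eq) (l , eq′) =
  toℕ-injective (m+kn≡o+ln⇒m≡o k l (toℕ<n y) (toℕ<n y′) (trans (sym eq) eq′))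

shiftEq-injective : ∀ {n x x′ d y} → ShiftEq n x d y → ShiftEq n x′ d y → x ≡ x′
shiftEq-injective {n} {x} {x′} {d} {y} (k , eq) (l , eq′) =
  toℕ-injective (m+kn≡o+ln⇒m≡o l k (toℕ<n x) (toℕ<n x′) (+-cancelʳ-≡ d _ _ (begin
    toℕ x + l * n + d     ≡⟨ xy∙z≈xz∙y (toℕ x) (l * n) d ⟩
    toℕ x + d + l * n     ≡⟨ cong (_+ l * n) eq ⟩
    toℕ y + k * n + l * n ≡⟨ xy∙z≈xz∙y (toℕ y) (k * n) (l * n) ⟩
    toℕ y + l * n + k * n ≡⟨ cong (_+ k * n) eq′ ⟨
    toℕ x′ + d + k * n    ≡⟨ xy∙z≈xz∙y (toℕ x′) d (k * n) ⟩
    toℕ x′ + k * n + d    ∎)))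
  where open ≡-Reasoning

circAdj-neighbours : ∀ {n s x j p₁ p₂ p₃ p₄} →
  ShiftEq n x 1 p₁ → ShiftEq n p₂ 1 x → ShiftEq n x s p₃ → ShiftEq n p₄ s x →
  CircAdj n s x j → j ≡ p₁ ⊎ j ≡ p₂ ⊎ j ≡ p₃ ⊎ j ≡ p₄
circAdj-neighbours {s = s} {x} w₁ w₂ w₃ w₄ =
  Sum.map (λ e → shiftEq-functional {x = x} e w₁)
  (Sum.map (λ e → shiftEq-injective {y = x} e w₂)
  (Sum.map (λ e → shiftEq-functional {x = x} {s} e w₃)
           (λ e → shiftEq-injective {d = s} {x} e w₄)))

module _ {n m m′ : ℕ} (m<n : m < n) (m′<n : m′ < n) where

  shiftEq-fromℕ< : ∀ {d} k → m + d ≡ m′ + k * n → ShiftEq n (fromℕ< m<n) d (fromℕ< m′<n)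
  shiftEq-fromℕ< {d} k = (k ,_) ∘
    subst₂ (λ x y → x + d ≡ y + k * n) (sym (toℕ-fromℕ< m<n)) (sym (toℕ-fromℕ< m′<n))

  shiftEq-within : ∀ {d} → m + d ≡ m′ → ShiftEq n (fromℕ< m<n) d (fromℕ< m′<n)
  shiftEq-within eq = shiftEq-fromℕ< 0 (trans eq (sym (+-identityʳ m′)))

  shiftEq-wrap : ∀ {d} → m + d ≡ m′ + n → ShiftEq n (fromℕ< m<n) d (fromℕ< m′<n)
  shiftEq-wrap eq = shiftEq-fromℕ< 1 (trans eq (cong (m′ +_) (sym (+-identityʳ n))))

module OddOrder (t : ℕ) where
  s n : ℕ
  s = suc t
  n = suc (s + s)

  0<n : 0 < n
  0<n = s≤s z≤n
  1<n : 1 < n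
  1<n = s≤s (s≤s z≤n)
  t<n : t < n
  t<n = s≤s (m≤n⇒m≤1+n (m≤m+n t s))
  s<n : s < n
  s<n = s≤s (m≤m+n s s)
  1+s<n : suc s < n
  1+s<n = s≤s (s≤s (m≤n+m s t))
  2s<n : s + s < n
  2s<n = n<1+n (s + s)

  u₀ u₁ uₛ₋₁ uₛ uₛ₊₁ u₂ₛ : Fin n
  u₀   = fromℕ< 0<n
  u₁   = fromℕ< 1<n
  uₛ₋₁ = fromℕ< t<n
  uₛ   = fromℕ< s<n
  uₛ₊₁ = fromℕ< 1+s<n
  u₂ₛ  = fromℕ< 2s<n

  circAdj-u₀ : ∀ {j} → CircAdj n s u₀ j → j ≡ u₁ ⊎ j ≡ u₂ₛ ⊎ j ≡ uₛ ⊎ j ≡ uₛ₊₁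
  circAdj-u₀ = circAdj-neighbours
    (shiftEq-within 0<n 1<n refl)
    (shiftEq-wrap 2s<n 0<n (+-comm (s + s) 1))
    (shiftEq-within 0<n s<n refl)
    (shiftEq-wrap 1+s<n 0<n refl)

  circAdj-uₛ : ∀ {j} → CircAdj n s uₛ j → j ≡ uₛ₊₁ ⊎ j ≡ uₛ₋₁ ⊎ j ≡ u₂ₛ ⊎ j ≡ u₀
  circAdj-uₛ = circAdj-neighbours
    (shiftEq-within s<n 1+s<n (+-comm s 1))
    (shiftEq-within t<n s<n (+-comm t 1))
    (shiftEq-within s<n 2s<n refl)
    (shiftEq-within 0<n s<n refl)

  uₛ≢u₂ₛ : ¬ uₛ ≡ u₂ₛ
  uₛ≢u₂ₛ = m≢1+n+m s ∘ fromℕ<-injective s (s + s) s<n 2s<n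

  not-cyclable : ¬ ThreeSpanningCyclable n s
  not-cyclable cyclable with cyclable u₀ uₛ u₂ₛ (λ ()) (λ ()) uₛ≢u₂ₛ
  ... | F , two-factor , _ , u₀≁uₛ , u₀≁u₂ₛ , uₛ≁u₂ₛ =
    u₀≁uₛ (sameCycle-of-neighbours-in two-factor F-neighbours-u₀ F-neighbours-uₛ)
    where
    open IsTwoFactor two-factor

    F-neighbours-u₀ : SupportedIn (F u₀) u₁ uₛ₋₁ uₛ₊₁
    F-neighbours-u₀ j e with circAdj-u₀ (edges u₀ j e)
    ... | inj₁ refl               = inj₁ refl
    ... | inj₂ (inj₁ refl)        = ⊥-elim (u₀≁u₂ₛ (e ◅ ε))
    ... | inj₂ (inj₂ (inj₁ refl)) = ⊥-elim (u₀≁uₛ (e ◅ ε))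
    ... | inj₂ (inj₂ (inj₂ refl)) = inj₂ (inj₂ refl)

    F-neighbours-uₛ : SupportedIn (F uₛ) u₁ uₛ₋₁ uₛ₊₁
    F-neighbours-uₛ j e with circAdj-uₛ (edges uₛ j e)
    ... | inj₁ refl               = inj₂ (inj₂ refl)
    ... | inj₂ (inj₁ refl)        = inj₂ (inj₁ refl)
    ... | inj₂ (inj₂ (inj₁ refl)) = ⊥-elim (uₛ≁u₂ₛ (e ◅ ε))
    ... | inj₂ (inj₂ (inj₂ refl)) = ⊥-elim (u₀≁uₛ (trans (symmetric u₀ uₛ) e ◅ ε))

module EvenOrder (t : ℕ) where
  s n : ℕ
  s = suc t
  n = suc (suc (s + s))

  0<n : 0 < n
  0<n = s≤s z≤n
  1<n : 1 < n
  1<n = s≤s (s≤s z≤n)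
  s<n : s < n
  s<n = s≤s (m≤n⇒m≤1+n (m≤m+n s s))
  1+s<n : suc s < n
  1+s<n = s≤s (s≤s (m≤m+n s s))
  2+s<n : suc (suc s) < n
  2+s<n = s≤s (s≤s (s≤s (m≤n+m s t)))
  1+2s<n : suc (s + s) < n
  1+2s<n = n<1+n (suc (s + s))

  u₀ u₁ uₛ uₛ₊₁ uₛ₊₂ u₂ₛ₊₁ : Fin n
  u₀    = fromℕ< 0<n
  u₁    = fromℕ< 1<n
  uₛ    = fromℕ< s<n
  uₛ₊₁  = fromℕ< 1+s<n
  uₛ₊₂  = fromℕ< 2+s<n
  u₂ₛ₊₁ = fromℕ< 1+2s<n

  circAdj-u₀ : ∀ {j} → CircAdj n s u₀ j → j ≡ u₁ ⊎ j ≡ u₂ₛ₊₁ ⊎ j ≡ uₛ ⊎ j ≡ uₛ₊₂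
  circAdj-u₀ = circAdj-neighbours
    (shiftEq-within 0<n 1<n refl)
    (shiftEq-wrap 1+2s<n 0<n (+-comm (suc (s + s)) 1))
    (shiftEq-within 0<n s<n refl)
    (shiftEq-wrap 2+s<n 0<n refl)

  circAdj-uₛ₊₁ : ∀ {j} → CircAdj n s uₛ₊₁ j → j ≡ uₛ₊₂ ⊎ j ≡ uₛ ⊎ j ≡ u₂ₛ₊₁ ⊎ j ≡ u₁
  circAdj-uₛ₊₁ = circAdj-neighbours
    (shiftEq-within 1+s<n 2+s<n (+-comm (suc s) 1))
    (shiftEq-within s<n 1+s<n (+-comm s 1))
    (shiftEq-within 1+s<n 1+2s<n refl)
    (shiftEq-within 1<n 1+s<n refl)

  not-cyclable : ¬ ThreeSpanningCyclable n s
  not-cyclable cyclable with cyclable u₀ u₁ uₛ₊₁ (λ ()) (λ ()) (λ ())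
  ... | F , two-factor , _ , u₀≁u₁ , u₀≁uₛ₊₁ , u₁≁uₛ₊₁ =
    u₀≁uₛ₊₁ (sameCycle-of-neighbours-in two-factor F-neighbours-u₀ F-neighbours-uₛ₊₁)
    where
    open IsTwoFactor two-factor

    F-neighbours-u₀ : SupportedIn (F u₀) u₂ₛ₊₁ uₛ uₛ₊₂
    F-neighbours-u₀ j e with circAdj-u₀ (edges u₀ j e)
    ... | inj₁ refl               = ⊥-elim (u₀≁u₁ (e ◅ ε))
    ... | inj₂ (inj₁ refl)        = inj₁ refl
    ... | inj₂ (inj₂ (inj₁ refl)) = inj₂ (inj₁ refl)
    ... | inj₂ (inj₂ (inj₂ refl)) = inj₂ (inj₂ refl)

    F-neighbours-uₛ₊₁ : SupportedIn (F uₛ₊₁) u₂ₛ₊₁ uₛ uₛ₊₂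
    F-neighbours-uₛ₊₁ j e with circAdj-uₛ₊₁ (edges uₛ₊₁ j e)
    ... | inj₁ refl               = inj₂ (inj₂ refl)
    ... | inj₂ (inj₁ refl)        = inj₂ (inj₁ refl)
    ... | inj₂ (inj₂ (inj₁ refl)) = inj₁ refl
    ... | inj₂ (inj₂ (inj₂ refl)) = ⊥-elim (u₁≁uₛ₊₁ (trans (symmetric u₁ uₛ₊₁) e ◅ ε))

theorem5p3 : (s n : ℕ) → 2 ≤ s → (n ≡ 2 * s + 1 ⊎ n ≡ 2 * s + 2) →
    gcd n s ≡ 1 → ¬ ThreeSpanningCyclable n s
theorem5p3 (suc t) n (s≤s _) (inj₁ refl) _ =
  subst (λ m → ¬ ThreeSpanningCyclable m (suc t)) (1+s+s≡2*s+1 (suc t)) (OddOrder.not-cyclable t)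
  where
  1+s+s≡2*s+1 : ∀ s → suc (s + s) ≡ 2 * s + 1
  1+s+s≡2*s+1 = solve-∀
theorem5p3 (suc t) n (s≤s _) (inj₂ refl) _ =
  subst (λ m → ¬ ThreeSpanningCyclable m (suc t)) (2+s+s≡2*s+2 (suc t)) (EvenOrder.not-cyclable t)
  where
  2+s+s≡2*s+2 : ∀ s → suc (suc (s + s)) ≡ 2 * s + 2
  2+s+s≡2*s+2 = solve-∀
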